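{- Let $(G,\bm{\gamma})$ be a $\mathbb{Z}/3\mathbb{Z}$-colored graph and $\tilde{G}$ its development. If $\tilde{G}$ is not Laman-sparse, then $(G,\bm{\gamma})$ is not cone-Laman-sparse.
   Context: A $\mathbb{Z}/3\mathbb{Z}$-colored graph is a finite directed (multi)graph $G=(V,E)$ with an element $\gamma_{ij}\in\mathbb{Z}/3\mathbb{Z}$ for each edge $ij$. For a cycle $C$ with a traversal order, $\rho(C)=\sum_{\text{forward}}\gamma_{ij}-\sum_{\text{backward}}\gamma_{ij}$; a subgraph has trivial image if $\rho(C)=0$ for every cycle in it, non-trivial otherwise. For a subgraph, $n'$ is the number of vertices it spans, $m'$ its number of edges. $(G,\bm{\gamma})$ is cone-Laman-sparse if every non-empty subgraph with trivial image has $m'\le 2n'-3$ and every one with non-trivial image has $m'\le 2n'-1$. A graph is Laman-sparse if every non-empty subgraph has $m'\le 2n'-3$. The development $\tilde G$ has vertices $i_0,i_1,i_2$ for each $i\in V$ and, for each directed edge $ij$, the undirected edges $i_tj_{t+\gamma_{ij}}$, $t\in\{0,1,2\}$ (mod 3). -}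

module Defs where

open import Data.Nat using (ℕ; zero; suc; _+_; _*_; _≤_; _∸_)
open import Data.Nat.DivMod using (_%_; m%n<n)
open import Data.Fin using (Fin; zero; suc; toℕ; fromℕ<; combine; remQuot; _≟_)
open import Data.Fin.Subset using (Subset; _∈_; ∣_∣; Nonempty; inside; outside)
open import Data.Vec using (tabulate)
open import Data.List using (List; allFin; foldr; map)
open import Data.Bool.ListAction using (any)
open import Data.Bool using (Bool; true; false; _∨_; _∧_)
open import Data.Product using (_×_; _,_; proj₁; proj₂)
open import Relation.Nullary using (¬_)
open import Relation.Nullary.Decidable using (⌊_⌋)
open import Relation.Binary.PropositionalEquality using (_≡_; _≢_)
open import Function using (Injective)

_+₃_ : Fin 3 → Fin 3 → Fin 3
a +₃ b = fromℕ< (m%n<n (toℕ a + toℕ b) 3)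

-₃_ : Fin 3 → Fin 3
-₃ a = fromℕ< (m%n<n (3 ∸ toℕ a) 3)

-- Finite directed multigraphs (loops and parallel edges allowed).
-- Vertices are Fin nV, edges are Fin nE, edge e goes from src e to tgt e.

record Graph : Set where
  field
    nV nE : ℕ
    src tgt : Fin nE → Fin nV

open Graph public

record ColoredGraph : Set where
  field
    graph : Graph
    γ : Fin (nE graph) → Fin 3

open ColoredGraph public

-- Subgraphs are given by their (non-empty) edge sets; the vertex set is
-- the set of vertices spanned by those edges.

incident : (G : Graph) → Fin (nE G) → Fin (nV G) → Bool
incident G e v = ⌊ src G e ≟ v ⌋ ∨ ⌊ tgt G e ≟ v ⌋

spanned : (G : Graph) → Subset (nE G) → Subset (nV G)
spanned G S = tabulate λ v →
  any (λ e → ⌊ Data.Fin.Subset.Properties._∈?_ e S ⌋ ∧ incident G e v) (allFin (nE G))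
  where import Data.Fin.Subset.Properties

-- m' = ∣ S ∣ , n' = ∣ spanned G S ∣

-- Laman-sparse (underlying undirected multigraph): every non-empty
-- subgraph has m' ≤ 2n' - 3, i.e. m' + 3 ≤ 2 n'.
LamanSparse : Graph → Set
LamanSparse G = ∀ (S : Subset (nE G)) → Nonempty S →
  ∣ S ∣ + 3 ≤ 2 * ∣ spanned G S ∣

-- Cycles: simple cycles in the underlying undirected multigraph, with a
-- traversal order.  A step is an edge with a direction (true = forward).

Step : Graph → Set
Step G = Fin (nE G) × Bool

stepStart : (G : Graph) → Step G → Fin (nV G)
stepStart G (e , true)  = src G e
stepStart G (e , false) = tgt G e

stepEnd : (G : Graph) → Step G → Fin (nV G)
stepEnd G (e , true)  = tgt G e
stepEnd G (e , false) = src G e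

next : {k : ℕ} → Fin (suc k) → Fin (suc k)
next {k} i = fromℕ< (m%n<n (suc (toℕ i)) (suc k))

record Cycle (G : Graph) (S : Subset (nE G)) : Set where
  field
    len    : ℕ
    step   : Fin (suc len) → Step G
    linked : ∀ i → stepEnd G (step i) ≡ stepStart G (step (next i))
    inSub  : ∀ i → proj₁ (step i) ∈ S
    edgesDistinct    : Injective _≡_ _≡_ (λ i → proj₁ (step i))
    verticesDistinct : Injective _≡_ _≡_ (λ i → stepStart G (step i))

open Cycle public

stepColor : (H : ColoredGraph) → Step (graph H) → Fin 3
stepColor H (e , true)  = γ H e
stepColor H (e , false) = -₃ (γ H e)

ρ : (H : ColoredGraph) {S : Subset (nE (graph H))} → Cycle (graph H) S → Fin 3
ρ H C = foldr _+₃_ zero (map (λ i → stepColor H (step C i)) (allFin (suc (len C))))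

TrivialImage : (H : ColoredGraph) → Subset (nE (graph H)) → Set
TrivialImage H S = ∀ (C : Cycle (graph H) S) → ρ H C ≡ zero

ConeLamanSparse : ColoredGraph → Set
ConeLamanSparse H = ∀ (S : Subset (nE (graph H))) → Nonempty S →
  (TrivialImage H S → ∣ S ∣ + 3 ≤ 2 * ∣ spanned (graph H) S ∣) ×
  (¬ TrivialImage H S → ∣ S ∣ + 1 ≤ 2 * ∣ spanned (graph H) S ∣)

-- Development: vertices i_t ↔ combine i t : Fin (nV * 3),
-- edges (e , t) ↔ combine e t : Fin (nE * 3), edge (e,t) joins
-- (src e)_t and (tgt e)_{t + γ e}.

development : ColoredGraph → Graph
development H = record
  { nV  = nV G * 3
  ; nE  = nE G * 3
  ; src = λ e' → combine (src G (proj₁ (remQuot {nE G} 3 e'))) (proj₂ (remQuot {nE G} 3 e'))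
  ; tgt = λ e' → combine (tgt G (proj₁ (remQuot {nE G} 3 e')))
                         (proj₂ (remQuot {nE G} 3 e') +₃ γ H (proj₁ (remQuot {nE G} 3 e')))
  }
  where G = graph H

module Submission where

-- We prove the contrapositive: cone-Laman sparsity of (G, γ) rules out a minimal
-- violator A of the Laman count 2n' - 3 in G̃ (a violator all of whose smaller
-- non-empty edge sets are sparse).  Z/3Z acts on G̃ by rotating the three lifts of
-- each vertex and edge; let B, C be the rotations of A and P its projection to G.
--  * If A and B share a vertex, the gluing lemma (two violators sharing a vertex
--    have a violating union when the smaller parts are sparse) applied twice shows
--    that A ∪ B ∪ C, the full lift of P, violates the count; hence P violates even
--    m' ≤ 2n' - 1, which cone-Laman sparsity imposes on every edge set.
--  * Otherwise every vertex and edge of G has at most one lift in A, so A defines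
--    a potential on P; then P has trivial image, |A| = |P| edges, and P spans no
--    more vertices than A, so the violator A forces P to violate m' ≤ 2n' - 3.
-- The file develops, in order: cardinalities of finite subsets, spanned vertex
-- sets, Z/3Z arithmetic, potentials and trivial image, the gluing lemma and the
-- minimal-violator induction (for arbitrary graphs), the bound m' ≤ 2n' - 1 from
-- cone-Laman sparsity, subsets of Fin (n * 3) organised in blocks of three, the
-- rotation symmetry of the development, and the two cases.

open import Defs
open import Data.Nat using (ℕ; zero; suc; _+_; _*_; _≤_; _<_; z≤n; s≤s; _≤?_; _<?_)
open import Data.Nat.Properties
  using ( +-suc; +-identityʳ; m≤m+n; n≤1+n; n<1+n; <⇒≱; ≮⇒≥; ≰⇒>; <-irrefl; ≤-refl; ≤-trans; ≤-antisym
        ; +-monoʳ-≤; +-monoˡ-≤; +-mono-≤; +-monoʳ-<; *-monoʳ-≤; *-suc; *-distribˡ-+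
        ; +-cancelʳ-≤; *-cancelˡ-≤; *-cancelˡ-≡; module ≤-Reasoning )
open import Data.Nat.DivMod using (m%n<n; n%n≡0; m<n⇒m%n≡m)
open import Data.Nat.Solver using (module +-*-Solver)
open import Data.Fin using (Fin; zero; suc; toℕ; fromℕ<; combine)
open import Data.Fin.Properties
  using (_≟_; all?; any?; toℕ-injective; toℕ-fromℕ<; toℕ<n; combine-surjective; combine-injective; remQuot-combine)
open import Data.Fin.Subset using (Subset; _∈_; _⊆_; _∪_; _∩_; ∣_∣; Nonempty; Empty)
open import Data.Fin.Subset.Properties
  using ( _∈?_; nonempty?; Empty-unique; ∣⊥∣≡0; drop-∷-⊆; p⊆q⇒∣p∣≤∣q∣; ⊆-antisym; ∩-comm
        ; x∈p∪q⁺; x∈p∪q⁻; x∈p∩q⁺; x∈p∩q⁻; p∩q⊆p; p∩q⊆q; p⊆p∪q; q⊆p∪q )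
open import Data.Vec using ([]; _∷_; lookup; tabulate; here; there)
open import Data.Vec.Properties using (lookup∘tabulate; []=⇒lookup; lookup⇒[]=)
open import Data.Bool using (Bool; true; false; T; _∨_)
open import Data.Bool.Properties using (T-≡; T-∨; T-∧; ∨-assoc; ∨-comm)
open import Data.List using (allFin; foldr; map) renaming (tabulate to tabulateL)
open import Data.List.Properties using (map-tabulate; tabulate-cong)
open import Data.List.Membership.Propositional.Properties using (∈-allFin)
open import Data.List.Relation.Unary.Any as Any using (satisfied)
open import Data.List.Relation.Unary.Any.Properties using (any⁺; any⁻)
open import Data.Empty using (⊥; ⊥-elim)
open import Data.Product using (∃; ∃-syntax; _×_; _,_; proj₁; proj₂)
open import Data.Sum as Sum using (_⊎_; inj₁; inj₂; [_,_]′)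
open import Function using (_∘_; id; Equivalence)
open import Relation.Nullary using (¬_; Dec; yes; no; contradiction)
open import Relation.Nullary.Decidable using (toWitness; fromWitness; decidable-stable; _⊎-dec_; ¬?)
open import Relation.Binary.PropositionalEquality

open +-*-Solver using (solve; _:+_; _:*_; _:=_; con)

∣∪∣+∣∩∣ : ∀ {n} (p q : Subset n) → ∣ p ∪ q ∣ + ∣ p ∩ q ∣ ≡ ∣ p ∣ + ∣ q ∣
∣∪∣+∣∩∣ [] [] = refl
∣∪∣+∣∩∣ (true ∷ p) (true ∷ q) = cong suc (trans (+-suc _ _) (trans (cong suc (∣∪∣+∣∩∣ p q)) (sym (+-suc _ _))))
∣∪∣+∣∩∣ (true ∷ p) (false ∷ q) = cong suc (∣∪∣+∣∩∣ p q)
∣∪∣+∣∩∣ (false ∷ p) (true ∷ q) = trans (cong suc (∣∪∣+∣∩∣ p q)) (sym (+-suc _ _))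
∣∪∣+∣∩∣ (false ∷ p) (false ∷ q) = ∣∪∣+∣∩∣ p q

∣∪∣≤ : ∀ {n} (p q : Subset n) → ∣ p ∪ q ∣ ≤ ∣ p ∣ + ∣ q ∣
∣∪∣≤ p q = subst (∣ p ∪ q ∣ ≤_) (∣∪∣+∣∩∣ p q) (m≤m+n _ _)

∣∣≡0 : ∀ {n} {p : Subset n} → Empty p → ∣ p ∣ ≡ 0
∣∣≡0 {n} e = trans (cong ∣_∣ (Empty-unique e)) (∣⊥∣≡0 n)

∣∣>0 : ∀ {n} {p : Subset n} → Nonempty p → 0 < ∣ p ∣
∣∣>0 {p = true ∷ p}  _                = s≤s z≤n
∣∣>0 {p = false ∷ p} (suc x , there x∈) = ∣∣>0 (x , x∈)

∣∪∣-disjoint : ∀ {n} (p q : Subset n) → Empty (p ∩ q) → ∣ p ∪ q ∣ ≡ ∣ p ∣ + ∣ q ∣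
∣∪∣-disjoint p q disj = begin
  ∣ p ∪ q ∣              ≡⟨ sym (+-identityʳ _) ⟩
  ∣ p ∪ q ∣ + 0          ≡⟨ cong (∣ p ∪ q ∣ +_) (sym (∣∣≡0 disj)) ⟩
  ∣ p ∪ q ∣ + ∣ p ∩ q ∣  ≡⟨ ∣∪∣+∣∩∣ p q ⟩
  ∣ p ∣ + ∣ q ∣          ∎
  where open ≡-Reasoning

⊆-∣∣-≥ : ∀ {n} (p q : Subset n) → p ⊆ q → ∣ q ∣ ≤ ∣ p ∣ → q ⊆ p
⊆-∣∣-≥ (true ∷ p)  (true ∷ q)  p⊆q (s≤s le) here        = here
⊆-∣∣-≥ (true ∷ p)  (true ∷ q)  p⊆q (s≤s le) (there x∈) = there (⊆-∣∣-≥ p q (drop-∷-⊆ p⊆q) le x∈)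
⊆-∣∣-≥ (true ∷ p)  (false ∷ q) p⊆q le x∈ with () ← p⊆q here
⊆-∣∣-≥ (false ∷ p) (true ∷ q)  p⊆q le x∈ = contradiction le (<⇒≱ (s≤s (p⊆q⇒∣p∣≤∣q∣ (drop-∷-⊆ p⊆q))))
⊆-∣∣-≥ (false ∷ p) (false ∷ q) p⊆q le (there x∈) = there (⊆-∣∣-≥ p q (drop-∷-⊆ p⊆q) le x∈)

∪-⊆ : ∀ {n} {X Y : Subset n} → Y ⊆ X → X ∪ Y ≡ X
∪-⊆ {X = X} {Y} Y⊆X = ⊆-antisym (λ x∈ → [ id , Y⊆X ]′ (x∈p∪q⁻ X Y x∈)) (p⊆p∪q Y)

∈-tabulate⁺ : ∀ {n} (f : Fin n → Bool) {i} → T (f i) → i ∈ tabulate f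
∈-tabulate⁺ f {i} t = lookup⇒[]= i _ (trans (lookup∘tabulate f i) (Equivalence.to T-≡ t))

∈-tabulate⁻ : ∀ {n} (f : Fin n → Bool) {i} → i ∈ tabulate f → T (f i)
∈-tabulate⁻ f {i} i∈ = Equivalence.from T-≡ (trans (sym (lookup∘tabulate f i)) ([]=⇒lookup i∈))

EndpointOf : (G : Graph) → Fin (nE G) → Fin (nV G) → Set
EndpointOf G e v = src G e ≡ v ⊎ tgt G e ≡ v

∈spanned⁺ : ∀ (G : Graph) {S e v} → e ∈ S → EndpointOf G e v → v ∈ spanned G S
∈spanned⁺ G {S} {e} {v} e∈S end =
  ∈-tabulate⁺ _ (any⁺ _ (Any.map (λ { refl → Equivalence.from T-∧ (fromWitness e∈S , incident⁺) }) (∈-allFin e)))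
  where
  incident⁺ : T (incident G e v)
  incident⁺ = Equivalence.from T-∨
    (Sum.map (fromWitness {a? = src G e ≟ v}) (fromWitness {a? = tgt G e ≟ v}) end)

∈spanned⁻ : ∀ (G : Graph) {S v} → v ∈ spanned G S → ∃[ e ] (e ∈ S × EndpointOf G e v)
∈spanned⁻ G {S} {v} v∈ with satisfied (any⁻ _ (allFin (nE G)) (∈-tabulate⁻ _ v∈))
... | e , t with Equivalence.to T-∧ t
... | e∈S , inc = e , toWitness e∈S ,
  Sum.map (toWitness {a? = src G e ≟ v}) (toWitness {a? = tgt G e ≟ v}) (Equivalence.to T-∨ inc)

module _ (G : Graph) where

  spanned-mono : ∀ {X Y} → X ⊆ Y → spanned G X ⊆ spanned G Y
  spanned-mono X⊆Y v∈ with ∈spanned⁻ G v∈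
  ... | e , e∈X , end = ∈spanned⁺ G (X⊆Y e∈X) end

  spanned-∪ : ∀ X Y → spanned G (X ∪ Y) ⊆ spanned G X ∪ spanned G Y
  spanned-∪ X Y v∈ with ∈spanned⁻ G v∈
  ... | e , e∈X∪Y , end = x∈p∪q⁺ (Sum.map (λ e∈ → ∈spanned⁺ G e∈ end) (λ e∈ → ∈spanned⁺ G e∈ end)
                                              (x∈p∪q⁻ X Y e∈X∪Y))

  spanned-∩ : ∀ X Y → spanned G (X ∩ Y) ⊆ spanned G X ∩ spanned G Y
  spanned-∩ X Y v∈ = x∈p∩q⁺ (spanned-mono (p∩q⊆p X Y) v∈ , spanned-mono (p∩q⊆q X Y) v∈)

_⊖₃_ : Fin 3 → Fin 3 → Fin 3
a ⊖₃ b = a +₃ (-₃ b)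

suc₃ : Fin 3 → Fin 3
suc₃ a = a +₃ suc zero

pred₃ : Fin 3 → Fin 3
pred₃ a = a +₃ suc (suc zero)

suc₃-pred₃ : ∀ a → suc₃ (pred₃ a) ≡ a
suc₃-pred₃ = toWitness {a? = all? λ a → suc₃ (pred₃ a) ≟ a} _

telescope₃ : ∀ a b c → (b ⊖₃ a) +₃ (c ⊖₃ b) ≡ c ⊖₃ a
telescope₃ = toWitness {a? = all? λ a → all? λ b → all? λ c → ((b ⊖₃ a) +₃ (c ⊖₃ b)) ≟ (c ⊖₃ a)} _

self-diff₃ : ∀ a → a ⊖₃ a ≡ zero
self-diff₃ = toWitness {a? = all? λ a → (a ⊖₃ a) ≟ zero} _

forward-diff₃ : ∀ a g → (a +₃ g) ⊖₃ a ≡ g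
forward-diff₃ = toWitness {a? = all? λ a → all? λ g → ((a +₃ g) ⊖₃ a) ≟ g} _

backward-diff₃ : ∀ a g → a ⊖₃ (a +₃ g) ≡ -₃ g
backward-diff₃ = toWitness {a? = all? λ a → all? λ g → (a ⊖₃ (a +₃ g)) ≟ (-₃ g)} _

sub-add₃ : ∀ a g → (a ⊖₃ g) +₃ g ≡ a
sub-add₃ = toWitness {a? = all? λ a → all? λ g → ((a ⊖₃ g) +₃ g) ≟ a} _

suc₃-+₃ : ∀ a g → suc₃ a +₃ g ≡ suc₃ (a +₃ g)
suc₃-+₃ = toWitness {a? = all? λ a → all? λ g → (suc₃ a +₃ g) ≟ suc₃ (a +₃ g)} _

suc₃-trichotomy : ∀ a b → a ≡ b ⊎ b ≡ suc₃ a ⊎ a ≡ suc₃ b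
suc₃-trichotomy = toWitness {a? = all? λ a → all? λ b → (a ≟ b) ⊎-dec ((b ≟ suc₃ a) ⊎-dec (a ≟ suc₃ b))} _

suc₃-no-fixpoint : ∀ a → suc₃ a ≢ a
suc₃-no-fixpoint = toWitness {a? = all? λ a → ¬? (suc₃ a ≟ a)} _

telescope-sum : ∀ n (u : ℕ → Fin 3) →
  foldr _+₃_ zero (tabulateL {n = n} λ i → u (suc (toℕ i)) ⊖₃ u (toℕ i)) ≡ u n ⊖₃ u 0
telescope-sum zero    u = sym (self-diff₃ (u 0))
telescope-sum (suc n) u = begin
  (u 1 ⊖₃ u 0) +₃ foldr _+₃_ zero (tabulateL {n = n} λ i → u (suc (suc (toℕ i))) ⊖₃ u (suc (toℕ i)))
    ≡⟨ cong ((u 1 ⊖₃ u 0) +₃_) (telescope-sum n (u ∘ suc)) ⟩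
  (u 1 ⊖₃ u 0) +₃ (u (suc n) ⊖₃ u 1)
    ≡⟨ telescope₃ (u 0) (u 1) (u (suc n)) ⟩
  u (suc n) ⊖₃ u 0 ∎
  where open ≡-Reasoning

-- Reading a natural number cyclically as an index of a cycle of length k + 1;
-- the cyclic successor `next` of Defs is `wrap ∘ suc ∘ toℕ` by definition.
wrap : ∀ {k} → ℕ → Fin (suc k)
wrap {k} m = fromℕ< (m%n<n m (suc k))

wrap-toℕ : ∀ {k} (i : Fin (suc k)) → wrap (toℕ i) ≡ i
wrap-toℕ {k} i = toℕ-injective (trans (toℕ-fromℕ< _) (m<n⇒m%n≡m (toℕ<n i)))

wrap-length : ∀ k → wrap {k} (suc k) ≡ zero
wrap-length k = toℕ-injective (trans (toℕ-fromℕ< _) (n%n≡0 (suc k)))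

IsPotential : (H : ColoredGraph) → Subset (nE (graph H)) → (Fin (nV (graph H)) → Fin 3) → Set
IsPotential H S p = ∀ {e} → e ∈ S → p (tgt (graph H) e) ≡ p (src (graph H) e) +₃ γ H e

step-color : ∀ H {S p} → IsPotential H S p → ∀ (s : Step (graph H)) → proj₁ s ∈ S →
  stepColor H s ≡ p (stepEnd (graph H) s) ⊖₃ p (stepStart (graph H) s)
step-color H {p = p} pot (e , true) e∈ =
  trans (sym (forward-diff₃ (p (src (graph H) e)) (γ H e))) (cong (_⊖₃ p (src (graph H) e)) (sym (pot e∈)))
step-color H {p = p} pot (e , false) e∈ =
  trans (sym (backward-diff₃ (p (src (graph H) e)) (γ H e))) (cong (p (src (graph H) e) ⊖₃_) (sym (pot e∈)))

-- An edge set admitting a potential has trivial image: ρ of every cycle telescopes to 0.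
potential⇒trivial : ∀ H {S} (p : Fin (nV (graph H)) → Fin 3) → IsPotential H S p → TrivialImage H S
potential⇒trivial H p pot C = begin
  foldr _+₃_ zero (map color (allFin (suc L)))  ≡⟨ cong (foldr _+₃_ zero) (map-tabulate (λ i → i) color) ⟩
  foldr _+₃_ zero (tabulateL color)            ≡⟨ cong (foldr _+₃_ zero) (tabulate-cong color-diff) ⟩
  foldr _+₃_ zero (tabulateL {n = suc L} λ i → u (suc (toℕ i)) ⊖₃ u (toℕ i)) ≡⟨ telescope-sum (suc L) u ⟩
  u (suc L) ⊖₃ u 0                             ≡⟨ cong (_⊖₃ u 0) (cong h (wrap-length L)) ⟩
  u 0 ⊖₃ u 0                                   ≡⟨ self-diff₃ (u 0) ⟩
  zero ∎
  where
  open ≡-Reasoning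
  L = len C
  color : Fin (suc L) → Fin 3
  color i = stepColor H (step C i)
  h : Fin (suc L) → Fin 3
  h i = p (stepStart (graph H) (step C i))
  u : ℕ → Fin 3
  u m = h (wrap m)
  color-diff : ∀ i → color i ≡ u (suc (toℕ i)) ⊖₃ u (toℕ i)
  color-diff i = trans (step-color H {p = p} pot (step C i) (inSub C i))
    (cong₂ _⊖₃_ (cong p (linked C i)) (cong h (sym (wrap-toℕ i))))

-- The counting step behind gluing two violators: with inclusion–exclusion for
-- edges (eU + eI = eX + eY) and vertices (vU + vI = vX + vY), if the shared part
-- satisfies eI + 2 ≤ 2 vI then a subset of vU vertices still violates the count.
glue-count : ∀ {eX eY eU eI vX vY vU vI w} → eU + eI ≡ eX + eY → vU + vI ≡ vX + vY → w ≤ vU →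
  2 * vX ≤ eX + 2 → 2 * vY ≤ eY + 2 → eI + 2 ≤ 2 * vI → 2 * w ≤ eU + 2
glue-count {eX} {eY} {eU} {eI} {vX} {vY} {vU} {vI} {w} edges verts w≤vU violX violY shared =
  +-cancelʳ-≤ (2 * vI) (2 * w) (eU + 2) (begin
    2 * w + 2 * vI          ≤⟨ +-monoˡ-≤ (2 * vI) (*-monoʳ-≤ 2 w≤vU) ⟩
    2 * vU + 2 * vI         ≡⟨ sym (*-distribˡ-+ 2 vU vI) ⟩
    2 * (vU + vI)           ≡⟨ cong (2 *_) verts ⟩
    2 * (vX + vY)           ≡⟨ *-distribˡ-+ 2 vX vY ⟩
    2 * vX + 2 * vY         ≤⟨ +-mono-≤ violX violY ⟩
    (eX + 2) + (eY + 2)     ≡⟨ solve 2 (λ x y → (x :+ con 2) :+ (y :+ con 2) := (x :+ y) :+ con 4) refl eX eY ⟩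
    (eX + eY) + 4           ≡⟨ cong (_+ 4) (sym edges) ⟩
    (eU + eI) + 4           ≡⟨ solve 2 (λ u i → (u :+ i) :+ con 4 := (u :+ con 2) :+ (i :+ con 2)) refl eU eI ⟩
    (eU + 2) + (eI + 2)     ≤⟨ +-monoʳ-≤ (eU + 2) shared ⟩
    (eU + 2) + 2 * vI       ∎)
  where open ≤-Reasoning

module _ (G : Graph) where

  -- A violator of the Laman count m' ≤ 2n' - 3.
  Violator : Subset (nE G) → Set
  Violator X = 2 * ∣ spanned G X ∣ ≤ ∣ X ∣ + 2

  LamanBelow : ℕ → Set
  LamanBelow k = ∀ Z → Nonempty Z → ∣ Z ∣ < k → ∣ Z ∣ + 3 ≤ 2 * ∣ spanned G Z ∣

  -- Two edge sets X, Y sharing a vertex, where all edge sets smaller than Y are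
  -- sparse: either Y ⊆ X, or X and Y have few common edges compared to their
  -- common vertices (by sparsity of X ∩ Y, or trivially if X ∩ Y = ∅).
  overlap-bound : ∀ X Y → LamanBelow ∣ Y ∣ → Nonempty (spanned G X ∩ spanned G Y) →
    Y ⊆ X ⊎ ∣ X ∩ Y ∣ + 2 ≤ 2 * ∣ spanned G X ∩ spanned G Y ∣
  overlap-bound X Y below shared with nonempty? (X ∩ Y)
  ... | no none = inj₂ (subst (λ k → k + 2 ≤ 2 * ∣ spanned G X ∩ spanned G Y ∣) (sym (∣∣≡0 none))
                             (*-monoʳ-≤ 2 (∣∣>0 shared)))
  ... | yes some with ∣ X ∩ Y ∣ <? ∣ Y ∣
  ...   | yes smaller = inj₂ (≤-trans (+-monoʳ-≤ ∣ X ∩ Y ∣ (n≤1+n 2))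
            (≤-trans (below (X ∩ Y) some smaller) (*-monoʳ-≤ 2 (p⊆q⇒∣p∣≤∣q∣ (spanned-∩ G X Y)))))
  ...   | no ¬smaller = inj₁ (λ y∈ → p∩q⊆p X Y (⊆-∣∣-≥ (X ∩ Y) Y (p∩q⊆q X Y) (≮⇒≥ ¬smaller) y∈))

  glue : ∀ X Y → LamanBelow ∣ Y ∣ → Violator X → Violator Y →
    Nonempty (spanned G X ∩ spanned G Y) → Violator (X ∪ Y)
  glue X Y below violX violY shared with overlap-bound X Y below shared
  ... | inj₁ Y⊆X  = subst Violator (sym (∪-⊆ Y⊆X)) violX
  ... | inj₂ few  = glue-count {vX = ∣ spanned G X ∣} {vY = ∣ spanned G Y ∣}
                      (∣∪∣+∣∩∣ X Y) (∣∪∣+∣∩∣ (spanned G X) (spanned G Y))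
                      (p⊆q⇒∣p∣≤∣q∣ (spanned-∪ G X Y)) violX violY few

  laman-from-minimal : (∀ X → Nonempty X → LamanBelow ∣ X ∣ → ¬ Violator X) → LamanSparse G
  laman-from-minimal no-minimal S nonempty = laman-below (suc ∣ S ∣) S nonempty ≤-refl
    where
    laman-below : ∀ k → LamanBelow k
    laman-below (suc k) Z nonempty (s≤s ∣Z∣≤k) with 2 * ∣ spanned G Z ∣ ≤? ∣ Z ∣ + 2
    ... | yes viol = contradiction viol
          (no-minimal Z nonempty (λ W ne lt → laman-below k W ne (≤-trans lt ∣Z∣≤k)))
    ... | no ¬viol = subst (_≤ 2 * ∣ spanned G Z ∣) (sym (+-suc ∣ Z ∣ 2)) (≰⇒> ¬viol)

cone-bound : ∀ H → ConeLamanSparse H → ∀ S → Nonempty S → ∣ S ∣ + 1 ≤ 2 * ∣ spanned (graph H) S ∣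
cone-bound H cone S nonempty = decidable-stable (_ ≤? _) λ ¬bound →
  ¬bound (proj₂ (cone S nonempty) λ trivial →
    ¬bound (≤-trans (+-monoʳ-≤ ∣ S ∣ (s≤s z≤n)) (proj₁ (cone S nonempty) trivial)))

-- Subsets of Fin (n * 3) = Fin n × Z/3Z, stored block by block: the element
-- combine v t is entry t of block v.  `rot` shifts every block by +1 in Z/3Z,
-- `lift P` is the full preimage of P ⊆ Fin n and `proj X` the image of X.
rot : ∀ {n} → Subset (n * 3) → Subset (n * 3)
rot {zero}  []                = []
rot {suc n} (a ∷ b ∷ c ∷ X) = c ∷ a ∷ b ∷ rot {n} X

lift : ∀ {n} → Subset n → Subset (n * 3)
lift []      = []
lift (a ∷ P) = a ∷ a ∷ a ∷ lift P

proj : ∀ {n} → Subset (n * 3) → Subset n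
proj {zero}  []                = []
proj {suc n} (a ∷ b ∷ c ∷ X) = (a ∨ b ∨ c) ∷ proj {n} X

rot-lookup : ∀ {n} (X : Subset (n * 3)) (v : Fin n) (t : Fin 3) →
  lookup (rot {n} X) (combine v (suc₃ t)) ≡ lookup X (combine v t)
rot-lookup {suc n} (a ∷ b ∷ c ∷ X) zero    zero                = refl
rot-lookup {suc n} (a ∷ b ∷ c ∷ X) zero    (suc zero)          = refl
rot-lookup {suc n} (a ∷ b ∷ c ∷ X) zero    (suc (suc zero))    = refl
rot-lookup {suc n} (a ∷ b ∷ c ∷ X) (suc v) t                   = rot-lookup {n} X v t

lift-lookup : ∀ {n} (P : Subset n) (v : Fin n) (t : Fin 3) →
  lookup (lift P) (combine v t) ≡ lookup P v
lift-lookup (a ∷ P) zero    zero             = refl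
lift-lookup (a ∷ P) zero    (suc zero)       = refl
lift-lookup (a ∷ P) zero    (suc (suc zero)) = refl
lift-lookup (a ∷ P) (suc v) t                = lift-lookup P v t

∈-rot⁺ : ∀ {n} {X : Subset (n * 3)} {v : Fin n} {t : Fin 3} →
  combine v t ∈ X → combine v (suc₃ t) ∈ rot {n} X
∈-rot⁺ {n} {X} {v} {t} x∈ = lookup⇒[]= _ _ (trans (rot-lookup {n} X v t) ([]=⇒lookup x∈))

∈-rot⁻ : ∀ {n} {X : Subset (n * 3)} {v : Fin n} {t : Fin 3} →
  combine v t ∈ rot {n} X → combine v (pred₃ t) ∈ X
∈-rot⁻ {n} {X} {v} {t} x∈ = lookup⇒[]= _ _ (begin
  lookup X (combine v (pred₃ t))                   ≡⟨ sym (rot-lookup {n} X v (pred₃ t)) ⟩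
  lookup (rot {n} X) (combine v (suc₃ (pred₃ t)))  ≡⟨ cong (λ s → lookup (rot {n} X) (combine v s)) (suc₃-pred₃ t) ⟩
  lookup (rot {n} X) (combine v t)                 ≡⟨ []=⇒lookup x∈ ⟩
  true ∎)
  where open ≡-Reasoning

∈-lift⁺ : ∀ {n} {P : Subset n} {v : Fin n} (t : Fin 3) → v ∈ P → combine v t ∈ lift P
∈-lift⁺ {P = P} {v} t v∈ = lookup⇒[]= _ _ (trans (lift-lookup P v t) ([]=⇒lookup v∈))

∈-lift⁻ : ∀ {n} {P : Subset n} {v : Fin n} {t : Fin 3} → combine v t ∈ lift P → v ∈ P
∈-lift⁻ {P = P} {v} {t} x∈ = lookup⇒[]= _ _ (trans (sym (lift-lookup P v t)) ([]=⇒lookup x∈))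

rot³ : ∀ {n} (X : Subset (n * 3)) → rot {n} (rot {n} (rot {n} X)) ≡ X
rot³ {zero}  []                = refl
rot³ {suc n} (a ∷ b ∷ c ∷ X) = cong (λ Y → a ∷ b ∷ c ∷ Y) (rot³ {n} X)

-- Rotation permutes each block, so it preserves size; it is a composite of two
-- transpositions of neighbouring entries.
∣rot∣ : ∀ {n} (X : Subset (n * 3)) → ∣ rot {n} X ∣ ≡ ∣ X ∣
∣rot∣ {zero}  []                = refl
∣rot∣ {suc n} (a ∷ b ∷ c ∷ X) = begin
  ∣ c ∷ a ∷ b ∷ rot {n} X ∣ ≡⟨ swap c a (b ∷ rot {n} X) ⟩
  ∣ a ∷ c ∷ b ∷ rot {n} X ∣ ≡⟨ ∣∷∣-cong a (c ∷ b ∷ rot {n} X) (b ∷ c ∷ rot {n} X) (swap c b (rot {n} X)) ⟩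
  ∣ a ∷ b ∷ c ∷ rot {n} X ∣ ≡⟨ ∣∷∣-cong a (b ∷ c ∷ rot {n} X) (b ∷ c ∷ X)
                                (∣∷∣-cong b (c ∷ rot {n} X) (c ∷ X) (∣∷∣-cong c (rot {n} X) X (∣rot∣ {n} X))) ⟩
  ∣ a ∷ b ∷ c ∷ X ∣ ∎
  where
  open ≡-Reasoning
  swap : ∀ {m} x y (Y : Subset m) → ∣ x ∷ y ∷ Y ∣ ≡ ∣ y ∷ x ∷ Y ∣
  swap true  true  Y = refl
  swap true  false Y = refl
  swap false true  Y = refl
  swap false false Y = refl
  ∣∷∣-cong : ∀ {m} x (Y Z : Subset m) → ∣ Y ∣ ≡ ∣ Z ∣ → ∣ x ∷ Y ∣ ≡ ∣ x ∷ Z ∣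
  ∣∷∣-cong true  Y Z eq = cong suc eq
  ∣∷∣-cong false Y Z eq = eq

∣lift∣ : ∀ {n} (P : Subset n) → ∣ lift P ∣ ≡ 3 * ∣ P ∣
∣lift∣ []        = refl
∣lift∣ (false ∷ P) = ∣lift∣ P
∣lift∣ (true ∷ P)  = trans (cong (3 +_) (∣lift∣ P)) (sym (*-suc 3 ∣ P ∣))

orbit : ∀ {n} → Subset (n * 3) → Subset (n * 3)
orbit {n} X = (X ∪ rot {n} X) ∪ rot {n} (rot {n} X)

orbit≡lift∘proj : ∀ {n} (X : Subset (n * 3)) → orbit {n} X ≡ lift (proj {n} X)
orbit≡lift∘proj {zero}  []                = refl
orbit≡lift∘proj {suc n} (a ∷ b ∷ c ∷ X) =
  cong₂ _∷_ (trans (∨-assoc a c b) (cong (a ∨_) (∨-comm c b))) (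
  cong₂ _∷_ (trans (cong (_∨ c) (∨-comm b a)) (∨-assoc a b c)) (
  cong₂ _∷_ (trans (∨-comm (c ∨ b) a) (cong (a ∨_) (∨-comm c b))) (orbit≡lift∘proj {n} X)))

∈-proj⁺ : ∀ {n} {X : Subset (n * 3)} {v : Fin n} {t : Fin 3} → combine v t ∈ X → v ∈ proj {n} X
∈-proj⁺ {n} {X} x∈ = ∈-lift⁻ (subst (_ ∈_) (orbit≡lift∘proj {n} X) (p⊆p∪q _ (p⊆p∪q _ x∈)))

∈-proj⁻ : ∀ {n} {X : Subset (n * 3)} {v : Fin n} → v ∈ proj {n} X → ∃[ t ] combine v t ∈ X
∈-proj⁻ {n} {X} {v} v∈ with x∈p∪q⁻ _ _ (subst (combine v zero ∈_) (sym (orbit≡lift∘proj {n} X)) (∈-lift⁺ zero v∈))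
... | inj₂ x∈rot²X = _ , ∈-rot⁻ {n} (∈-rot⁻ {n} x∈rot²X)
... | inj₁ x∈X∪rotX with x∈p∪q⁻ X _ x∈X∪rotX
...   | inj₁ x∈X    = _ , x∈X
...   | inj₂ x∈rotX = _ , ∈-rot⁻ {n} x∈rotX

Section : ∀ {n} → Subset (n * 3) → Set
Section {n} X = ∀ {v : Fin n} {t t' : Fin 3} → combine v t ∈ X → combine v t' ∈ X → t ≡ t'

rot-section : ∀ {n} {X : Subset (n * 3)} → Section {n} X → Section {n} (rot {n} X)
rot-section {n} sec x∈ x'∈ =
  trans (sym (suc₃-pred₃ _)) (trans (cong suc₃ (sec (∈-rot⁻ {n} x∈) (∈-rot⁻ {n} x'∈))) (suc₃-pred₃ _))

section-rot-disjoint : ∀ {n} {X : Subset (n * 3)} → Section {n} X → Empty (X ∩ rot {n} X)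
section-rot-disjoint {n} {X} sec (x , x∈) with combine-surjective {n} {3} x
... | v , t , refl with x∈p∩q⁻ X _ x∈
... | x∈X , x∈rotX = suc₃-no-fixpoint t (begin
  suc₃ t          ≡⟨ cong suc₃ (sec x∈X (∈-rot⁻ {n} x∈rotX)) ⟩
  suc₃ (pred₃ t)  ≡⟨ suc₃-pred₃ t ⟩
  t ∎)
  where open ≡-Reasoning

section-rot²-disjoint : ∀ {n} {X : Subset (n * 3)} → Section {n} X → Empty (X ∩ rot {n} (rot {n} X))
section-rot²-disjoint {n} {X} sec =
  subst Empty (trans (cong (rot {n} (rot {n} X) ∩_) (rot³ {n} X)) (∩-comm _ X))
    (section-rot-disjoint {n} (rot-section {n} (rot-section {n} sec)))

∣orbit∣-section : ∀ {n} {X : Subset (n * 3)} → Section {n} X → ∣ orbit {n} X ∣ ≡ 3 * ∣ X ∣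
∣orbit∣-section {n} {X} sec = begin
  ∣ (X ∪ rot {n} X) ∪ rot {n} (rot {n} X) ∣ ≡⟨ ∣∪∣-disjoint _ _ XY∩Z-empty ⟩
  ∣ X ∪ rot {n} X ∣ + ∣ rot {n} (rot {n} X) ∣
    ≡⟨ cong₂ _+_ (∣∪∣-disjoint _ _ (section-rot-disjoint {n} sec)) ∣rot²∣ ⟩
  ∣ X ∣ + ∣ rot {n} X ∣ + ∣ X ∣               ≡⟨ cong (λ k → ∣ X ∣ + k + ∣ X ∣) (∣rot∣ {n} X) ⟩
  ∣ X ∣ + ∣ X ∣ + ∣ X ∣                       ≡⟨ solve 1 (λ k → k :+ k :+ k := con 3 :* k) refl ∣ X ∣ ⟩
  3 * ∣ X ∣ ∎
  where
  open ≡-Reasoning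
  ∣rot²∣ : ∣ rot {n} (rot {n} X) ∣ ≡ ∣ X ∣
  ∣rot²∣ = trans (∣rot∣ {n} (rot {n} X)) (∣rot∣ {n} X)
  XY∩Z-empty : Empty ((X ∪ rot {n} X) ∩ rot {n} (rot {n} X))
  XY∩Z-empty (x , x∈) with x∈p∩q⁻ (X ∪ rot {n} X) _ x∈
  ... | x∈XY , x∈Z with x∈p∪q⁻ X _ x∈XY
  ...   | inj₁ x∈X = section-rot²-disjoint {n} sec (x , x∈p∩q⁺ (x∈X , x∈Z))
  ...   | inj₂ x∈Y = section-rot-disjoint {n} (rot-section {n} sec) (x , x∈p∩q⁺ (x∈Y , x∈Z))

choose : ∀ {A : Set} {P : A → Set} → A → Dec (∃ P) → A
choose _ (yes (a , _)) = a
choose a₀ (no _)      = a₀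

choose-unique : ∀ {A : Set} {P : A → Set} (a₀ : A) → (∀ {a b} → P a → P b → a ≡ b) →
  (d : Dec (∃ P)) → ∀ {a} → P a → choose a₀ d ≡ a
choose-unique a₀ unique (yes (b , pb)) pa = unique pb pa
choose-unique a₀ unique (no none)      pa = ⊥-elim (none (_ , pa))

module Development (H : ColoredGraph) where

  G D : Graph
  G = graph H
  D = development H

  V : Subset (nE G * 3) → Subset (nV G * 3)
  V = spanned D

  src-lift : ∀ (e : Fin (nE G)) t → src D (combine e t) ≡ combine (src G e) t
  src-lift e t = cong (λ p → combine (src G (proj₁ p)) (proj₂ p)) (remQuot-combine {nE G} {3} e t)

  tgt-lift : ∀ (e : Fin (nE G)) t → tgt D (combine e t) ≡ combine (tgt G e) (t +₃ γ H e)
  tgt-lift e t =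
    cong (λ p → combine (tgt G (proj₁ p)) (proj₂ p +₃ γ H (proj₁ p))) (remQuot-combine {nE G} {3} e t)

  endpoint-rot : ∀ {e : Fin (nE G)} {v : Fin (nV G)} {t s} → EndpointOf D (combine e t) (combine v s) →
    EndpointOf D (combine e (suc₃ t)) (combine v (suc₃ s))
  endpoint-rot {e} {v} {t} {s} (inj₁ eq) with combine-injective (src G e) t v s (trans (sym (src-lift e t)) eq)
  ... | refl , refl = inj₁ (src-lift e (suc₃ t))
  endpoint-rot {e} {v} {t} {s} (inj₂ eq) with combine-injective (tgt G e) _ v s (trans (sym (tgt-lift e t)) eq)
  ... | refl , refl = inj₂ (trans (tgt-lift e (suc₃ t)) (cong (combine (tgt G e)) (suc₃-+₃ t (γ H e))))

  -- Hence rotating an edge set rotates the vertices it spans (one inclusion suffices).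
  rot-spanned : ∀ X → rot {nV G} (V X) ⊆ V (rot {nE G} X)
  rot-spanned X {w} w∈ with combine-surjective {nV G} {3} w
  ... | v , s , refl with ∈spanned⁻ D (∈-rot⁻ {nV G} w∈)
  ... | x , x∈X , end with combine-surjective {nE G} {3} x
  ... | e , t , refl = ∈spanned⁺ D (∈-rot⁺ {nE G} x∈X)
                         (subst (EndpointOf D _) (cong (combine v) (suc₃-pred₃ s)) (endpoint-rot end))

  ∣V∘rot∣ : ∀ X → ∣ V (rot {nE G} X) ∣ ≡ ∣ V X ∣
  ∣V∘rot∣ X = ≤-antisym (begin
      ∣ V (rot {nE G} X) ∣                            ≤⟨ grows (rot {nE G} X) ⟩
      ∣ V (rot {nE G} (rot {nE G} X)) ∣               ≤⟨ grows (rot {nE G} (rot {nE G} X)) ⟩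
      ∣ V (rot {nE G} (rot {nE G} (rot {nE G} X))) ∣  ≡⟨ cong (λ Y → ∣ V Y ∣) (rot³ {nE G} X) ⟩
      ∣ V X ∣ ∎)
    (grows X)
    where
    open ≤-Reasoning
    grows : ∀ Y → ∣ V Y ∣ ≤ ∣ V (rot {nE G} Y) ∣
    grows Y = subst (_≤ ∣ V (rot {nE G} Y) ∣) (∣rot∣ {nV G} (V Y)) (p⊆q⇒∣p∣≤∣q∣ (rot-spanned Y))

  rot-violator : ∀ {X} → Violator D X → Violator D (rot {nE G} X)
  rot-violator {X} viol = subst₂ (λ v e → 2 * v ≤ e + 2) (sym (∣V∘rot∣ X)) (sym (∣rot∣ {nE G} X)) viol

  lift-spanned : ∀ P → lift {nV G} (spanned G P) ⊆ V (lift P)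
  lift-spanned P {w} w∈ with combine-surjective {nV G} {3} w
  ... | v , s , refl with ∈spanned⁻ G (∈-lift⁻ w∈)
  ... | e , e∈P , inj₁ refl = ∈spanned⁺ D (∈-lift⁺ s e∈P) (inj₁ (src-lift e s))
  ... | e , e∈P , inj₂ refl = ∈spanned⁺ D (∈-lift⁺ (s ⊖₃ γ H e) e∈P)
                                (inj₂ (trans (tgt-lift e _) (cong (combine (tgt G e)) (sub-add₃ s (γ H e)))))

  section-edges : ∀ {X} → Section {nV G} (V X) → Section {nE G} X
  section-edges sec {e} x∈ x'∈ =
    sec (∈spanned⁺ D x∈ (inj₁ (src-lift e _))) (∈spanned⁺ D x'∈ (inj₁ (src-lift e _)))

  section-vertices : ∀ {X} → Empty (V X ∩ V (rot {nE G} X)) → Section {nV G} (V X)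
  section-vertices {X} disj {v} {t} {t'} x∈ x'∈ with suc₃-trichotomy t t'
  ... | inj₁ t≡t'           = t≡t'
  ... | inj₂ (inj₁ refl)    = ⊥-elim (disj (_ , x∈p∩q⁺ (x'∈ , rot-spanned X (∈-rot⁺ {nV G} x∈))))
  ... | inj₂ (inj₂ refl)    = ⊥-elim (disj (_ , x∈p∩q⁺ (x∈ , rot-spanned X (∈-rot⁺ {nV G} x'∈))))

  section-potential : ∀ {X} → Section {nV G} (V X) →
    ∃[ p ] IsPotential H (proj {nE G} X) p
  section-potential {X} sec = p , potential
    where
    p : Fin (nV G) → Fin 3
    p v = choose zero (any? λ t → combine v t ∈? V X)
    p-lift : ∀ {v t} → combine v t ∈ V X → p v ≡ t
    p-lift {v} = choose-unique zero sec (any? λ t → combine v t ∈? V X)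
    potential : IsPotential H (proj {nE G} X) p
    potential {e} e∈ with ∈-proj⁻ {nE G} e∈
    ... | t , x∈ = trans (p-lift (∈spanned⁺ D x∈ (inj₂ (tgt-lift e t))))
                         (cong (_+₃ γ H e) (sym (p-lift (∈spanned⁺ D x∈ (inj₁ (src-lift e t))))))

  ∣orbit∣ : ∀ A → ∣ orbit {nE G} A ∣ ≡ 3 * ∣ proj {nE G} A ∣
  ∣orbit∣ A = trans (cong ∣_∣ (orbit≡lift∘proj {nE G} A)) (∣lift∣ (proj {nE G} A))

  orbit-spans : ∀ A → 3 * ∣ spanned G (proj {nE G} A) ∣ ≤ ∣ V (orbit {nE G} A) ∣
  orbit-spans A =
    subst₂ _≤_ (∣lift∣ (spanned G (proj {nE G} A))) (cong (λ Y → ∣ V Y ∣) (sym (orbit≡lift∘proj {nE G} A)))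
      (p⊆q⇒∣p∣≤∣q∣ (lift-spanned (proj {nE G} A)))

  ∣V∘orbit∣ : ∀ A → ∣ V (orbit {nE G} A) ∣ ≤ 3 * ∣ V A ∣
  ∣V∘orbit∣ A = begin
    ∣ V ((A ∪ B) ∪ C) ∣              ≤⟨ p⊆q⇒∣p∣≤∣q∣ (spanned-∪ D (A ∪ B) C) ⟩
    ∣ V (A ∪ B) ∪ V C ∣              ≤⟨ ∣∪∣≤ (V (A ∪ B)) (V C) ⟩
    ∣ V (A ∪ B) ∣ + ∣ V C ∣          ≤⟨ +-monoˡ-≤ _ (≤-trans (p⊆q⇒∣p∣≤∣q∣ (spanned-∪ D A B)) (∣∪∣≤ (V A) (V B))) ⟩
    ∣ V A ∣ + ∣ V B ∣ + ∣ V C ∣      ≡⟨ cong₂ (λ b c → ∣ V A ∣ + b + c) (∣V∘rot∣ A) (trans (∣V∘rot∣ B) (∣V∘rot∣ A)) ⟩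
    ∣ V A ∣ + ∣ V A ∣ + ∣ V A ∣      ≡⟨ solve 1 (λ k → k :+ k :+ k := con 3 :* k) refl ∣ V A ∣ ⟩
    3 * ∣ V A ∣ ∎
    where
    open ≤-Reasoning
    B C : Subset (nE G * 3)
    B = rot {nE G} A
    C = rot {nE G} B

orbit-too-dense : ∀ m n → 2 * (3 * n) ≤ 3 * m + 2 → m + 1 ≤ 2 * n → ⊥
orbit-too-dense m n orbit-violates bound = <-irrefl refl (begin-strict
  3 * m + 2        <⟨ +-monoʳ-< (3 * m) (n<1+n 2) ⟩
  3 * m + 3        ≡⟨ solve 1 (λ m → con 3 :* m :+ con 3 := con 3 :* (m :+ con 1)) refl m ⟩
  3 * (m + 1)      ≤⟨ *-monoʳ-≤ 3 bound ⟩
  3 * (2 * n)      ≡⟨ solve 1 (λ n → con 3 :* (con 2 :* n) := con 2 :* (con 3 :* n)) refl n ⟩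
  2 * (3 * n)      ≤⟨ orbit-violates ⟩
  3 * m + 2        ∎)
  where open ≤-Reasoning

module MinimalViolator (H : ColoredGraph) (cone : ConeLamanSparse H) where
  open Development H

  module _ (A : Subset (nE G * 3)) (viol : Violator D A) where

    B C : Subset (nE G * 3)
    B = rot {nE G} A
    C = rot {nE G} B

    P : Subset (nE G)
    P = proj {nE G} A

    m n : ℕ
    m = ∣ P ∣
    n = ∣ spanned G P ∣

    P-nonempty : Nonempty A → Nonempty P
    P-nonempty (x , x∈A) with combine-surjective {nE G} {3} x
    ... | e , t , refl = e , ∈-proj⁺ {nE G} x∈A

    -- If A meets its rotation, gluing A, B and C shows that the orbit, the full lift
    -- of P, violates the count; then P is too dense for cone-Laman sparsity.
    meeting-impossible : Nonempty A → LamanBelow D ∣ A ∣ → Nonempty (V A ∩ V B) → ⊥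
    meeting-impossible nonempty below shared =
      orbit-too-dense m n orbit-violates (cone-bound H cone P (P-nonempty nonempty))
      where
      violB : Violator D B
      violB = rot-violator viol
      violC : Violator D C
      violC = rot-violator violB
      belowB : LamanBelow D ∣ B ∣
      belowB = subst (LamanBelow D) (sym (∣rot∣ {nE G} A)) below
      belowC : LamanBelow D ∣ C ∣
      belowC = subst (LamanBelow D) (sym (trans (∣rot∣ {nE G} B) (∣rot∣ {nE G} A))) below
      rotate-shared : Nonempty (V A ∩ V B) → Nonempty (V (A ∪ B) ∩ V C)
      rotate-shared (w , w∈) with combine-surjective {nV G} {3} w | x∈p∩q⁻ (V A) (V B) w∈
      ... | v , s , refl | w∈A , w∈B = _ , x∈p∩q⁺
              ( spanned-mono D (q⊆p∪q A B) (rot-spanned A (∈-rot⁺ {nV G} w∈A))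
              , rot-spanned B (∈-rot⁺ {nV G} w∈B) )
      orbit-violates : 2 * (3 * n) ≤ 3 * m + 2
      orbit-violates = ≤-trans (*-monoʳ-≤ 2 (orbit-spans A))
        (subst (λ k → 2 * ∣ V (orbit {nE G} A) ∣ ≤ k + 2) (∣orbit∣ A)
          (glue D (A ∪ B) C belowC (glue D A B belowB viol violB shared) violC (rotate-shared shared)))

    -- If A does not meet its rotation, A is a section over P carrying a potential:
    -- P has trivial image, as many edges as A and at most as many vertices.
    separated-impossible : Nonempty A → Empty (V A ∩ V B) → ⊥
    separated-impossible nonempty disjoint = <-irrefl refl (begin-strict
      m + 2          <⟨ +-monoʳ-< m (n<1+n 2) ⟩
      m + 3          ≤⟨ proj₁ (cone P (P-nonempty nonempty)) trivial ⟩
      2 * n          ≤⟨ *-monoʳ-≤ 2 n≤∣VA∣ ⟩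
      2 * ∣ V A ∣    ≤⟨ viol ⟩
      ∣ A ∣ + 2      ≡⟨ cong (_+ 2) ∣A∣≡m ⟩
      m + 2          ∎)
      where
      open ≤-Reasoning
      vertex-section : Section {nV G} (V A)
      vertex-section = section-vertices disjoint
      trivial : TrivialImage H P
      trivial with section-potential vertex-section
      ... | p , potential = potential⇒trivial H p potential
      ∣A∣≡m : ∣ A ∣ ≡ m
      ∣A∣≡m = *-cancelˡ-≡ ∣ A ∣ m 3
        (trans (sym (∣orbit∣-section {nE G} (section-edges vertex-section))) (∣orbit∣ A))
      n≤∣VA∣ : n ≤ ∣ V A ∣
      n≤∣VA∣ = *-cancelˡ-≤ 3 (≤-trans (orbit-spans A) (∣V∘orbit∣ A))

  no-minimal-violator : ∀ A → Nonempty A → LamanBelow D ∣ A ∣ → ¬ Violator D A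
  no-minimal-violator A nonempty below viol with nonempty? (V A ∩ V (rot {nE G} A))
  ... | yes shared  = meeting-impossible A viol nonempty below shared
  ... | no disjoint = separated-impossible A viol nonempty disjoint

mainTheorem14 : (H : ColoredGraph) → ¬ LamanSparse (development H) → ¬ ConeLamanSparse H
mainTheorem14 H not-sparse cone =
  not-sparse (laman-from-minimal (development H) (MinimalViolator.no-minimal-violator H cone))
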